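{- Let $G$ be an augmented double star on $n$ vertices with $n\ge 12$, and let $\vec G$ be any orientation of $G$. Then $\lceil 2\sqrt n-1\rceil<\operatorname{th}(\vec G)<n$.
   Context: A double star is a tree with exactly two non-leaf vertices $a,b$ (adjacent to each other), each adjacent to at least one leaf. An augmented double star on $n$ vertices is obtained from a double star on $n-1$ vertices with internal vertices $a,b$ by deleting the edge $ab$, adding a new vertex $w$, and adding edges $aw$ and $bw$. An orientation of an undirected graph replaces each edge $\{u,v\}$ by exactly one of $(u,v)$, $(v,u)$. Zero forcing on a digraph: vertices are blue or white; a blue vertex $u$ with exactly one white out-neighbor $w$ may force $w$ ($u\to w$), turning it blue. A set $\mathcal F$ of forces is a set of forces of $B\subseteq V$ if, starting with exactly $B$ blue, the forces in $\mathcal F$ can be validly performed in some order after which no further force is possible. Put $\mathcal F^{[0]}=B$ and $\mathcal F^{[t+1]}=\mathcal F^{[t]}\cup\{w\notin\mathcal F^{[t]}:(u\to w)\in\mathcal F,\ u\in\mathcal F^{[t]},\ w$ the only out-neighbor of $u$ outside $\mathcal F^{[t]}\}$; $\operatorname{pt}(\Gamma;\mathcal F)$ is the least $t$ with $\mathcal F^{[t]}=V$ ($\infty$ if none); $\operatorname{pt}(\Gamma;B)=\min_{\mathcal F}\operatorname{pt}(\Gamma;\mathcal F)$. The throttling number is $\operatorname{th}(\Gamma)=\min_{B\subseteq V}(|B|+\operatorname{pt}(\Gamma;B))$. -}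

module Defs where

open import Data.Nat using (ℕ; zero; suc; _+_; _*_; _≤_; _<_)
open import Data.Fin using (Fin; _≟_)
open import Data.Bool using (Bool; true; false; _∧_; _∨_; not; if_then_else_)
open import Data.List using (List; []; _∷_; allFin; map)
open import Data.Bool.ListAction using (any; all)
open import Data.Nat.ListAction using (sum)
open import Data.Product using (Σ; _×_; _,_; ∃-syntax)
open import Data.Sum using (_⊎_)
open import Relation.Nullary using (¬_)
open import Relation.Nullary.Decidable using (⌊_⌋)
open import Relation.Binary.PropositionalEquality using (_≡_; _≢_)

Graph : ℕ → Set
Graph n = Fin n → Fin n → Bool

Digraph : ℕ → Set
Digraph n = Fin n → Fin n → Bool

_==_ : ∀ {n} → Fin n → Fin n → Bool
x == y = ⌊ x ≟ y ⌋

-- Edge set of the augmented double star with centres a, b, middle vertex w,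
-- and every other vertex v a leaf attached to a (side v = true) or to b (side v = false).
adsEdge : ∀ {n} → Fin n → Fin n → Fin n → (Fin n → Bool) → Fin n → Fin n → Bool
adsEdge a b w side u v =
     (u == a ∧ v == w) ∨ (u == w ∧ v == a)
  ∨ (u == b ∧ v == w) ∨ (u == w ∧ v == b)
  ∨ (u == a ∧ isLeaf v ∧ side v) ∨ (v == a ∧ isLeaf u ∧ side u)
  ∨ (u == b ∧ isLeaf v ∧ not (side v)) ∨ (v == b ∧ isLeaf u ∧ not (side u))
  where
  isLeaf : _ → Bool
  isLeaf x = not (x == a) ∧ not (x == b) ∧ not (x == w)

-- G (on vertex set Fin n) is an augmented double star: obtained from a double star on
-- n-1 vertices with centres a,b (each with at least one leaf) by deleting ab and adding
-- a new vertex w adjacent to a and b.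
IsAugmentedDoubleStar : ∀ {n} → Graph n → Set
IsAugmentedDoubleStar {n} G =
  Σ (Fin n) λ a → Σ (Fin n) λ b → Σ (Fin n) λ w → Σ (Fin n → Bool) λ side →
    a ≢ b × a ≢ w × b ≢ w
  × (∃[ x ] (x ≢ a × x ≢ b × x ≢ w × side x ≡ true))
  × (∃[ y ] (y ≢ a × y ≢ b × y ≢ w × side y ≡ false))
  × (∀ u v → G u v ≡ adsEdge a b w side u v)

IsOrientation : ∀ {n} → Graph n → Digraph n → Set
IsOrientation G D =
    (∀ u v → D u v ≡ true → G u v ≡ true)
  × (∀ u v → G u v ≡ true → (D u v ≡ true × D v u ≡ false) ⊎ (D u v ≡ false × D v u ≡ true))

-- Colourings: blue = true.
Colouring : ℕ → Set
Colouring n = Fin n → Bool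

Force : ℕ → Set
Force n = Fin n × Fin n     -- (u , w) means u → w

ValidForce : ∀ {n} → Digraph n → Colouring n → Fin n → Fin n → Set
ValidForce D S u w =
  S u ≡ true × S w ≡ false × D u w ≡ true
  × (∀ x → D u x ≡ true → S x ≡ false → x ≡ w)

paint : ∀ {n} → Colouring n → Fin n → Colouring n
paint S w x = S x ∨ (x == w)

ValidSeq : ∀ {n} → Digraph n → Colouring n → List (Force n) → Set
ValidSeq D S [] = Data.Unit.⊤ where import Data.Unit
ValidSeq D S ((u , w) ∷ fs) = ValidForce D S u w × ValidSeq D (paint S w) fs

run : ∀ {n} → Colouring n → List (Force n) → Colouring n
run S [] = S
run S ((u , w) ∷ fs) = run (paint S w) fs

Stalled : ∀ {n} → Digraph n → Colouring n → Set
Stalled D S = ∀ u w → ¬ ValidForce D S u w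

-- F (listed in an order in which the forces can be performed) is a set of forces of B.
IsForceSet : ∀ {n} → Digraph n → Colouring n → List (Force n) → Set
IsForceSet D B F = ValidSeq D B F × Stalled D (run B F)

step : ∀ {n} → Digraph n → List (Force n) → Colouring n → Colouring n
step {n} D F S x = S x ∨ any fires F
  where
  fires : Force n → Bool
  fires (u , w) = (w == x) ∧ S u ∧ D u x
                  ∧ all (λ y → not (D u y) ∨ S y ∨ (y == x)) (allFin n)

iter : ∀ {n} → Digraph n → List (Force n) → Colouring n → ℕ → Colouring n
iter D F B zero = B
iter D F B (suc t) = step D F (iter D F B t)

AllBlue : ∀ {n} → Colouring n → Set
AllBlue S = ∀ x → S x ≡ true

size : ∀ {n} → Colouring n → ℕ
size {n} B = sum (map (λ x → if B x then 1 else 0) (allFin n))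

IsThrottlingNumber : ∀ {n} → Digraph n → ℕ → Set
IsThrottlingNumber D k =
    (Σ _ λ B → Σ _ λ F → Σ ℕ λ t →
       IsForceSet D B F × AllBlue (iter D F B t) × size B + t ≡ k)
  × (∀ B F t → IsForceSet D B F → AllBlue (iter D F B t) → k ≤ size B + t)

-- c = ⌈2√n − 1⌉ (for n ≥ 1): c ≥ 2√n − 1 and c − 1 < 2√n − 1,
-- i.e. 4n ≤ (c+1)² and c² < 4n.
IsCeil2SqrtMinus1 : ℕ → ℕ → Set
IsCeil2SqrtMinus1 n c = 4 * n ≤ suc c * suc c × c * c < 4 * n

module Submission where

-- * The throttling number exists: the values |B| + t realised by a blue set B,
--   a set of forces F of B and a completion time t form a decidable set of
--   naturals (B ranges over the 2ⁿ colourings, F over lists of at most n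
--   forces, and t is then determined), so it has a least element.
-- * Upper bound: for a leaf x on side a and a leaf y on side b, orient the
--   edges a–x and b–y.  In each of the four cases there are forces f₁ → v₁ and
--   f₂ → v₂ with f₁ ↛ v₂ and f₂ ↛ v₁, so B = V ∖ {v₁, v₂} is finished in one
--   round and th ≤ (n − 2) + 1.
-- * Lower bound: a vertex forces at most once and a leaf can only be forced by
--   its centre, so a blue set B that eventually colours V misses at most a, b,
--   w and one leaf per centre: n ≤ |B| + 5 ≤ th + 5.  For n ≥ 12 this beats
--   every c with c² < 4n, in particular c = ⌈2√n − 1⌉.

open import Defs
open import Data.Nat using (ℕ; zero; suc; _+_; _*_; _∸_; _≤_; _<_; z≤n; s≤s)
open import Data.Nat.Properties hiding (_≟_)
open import Data.Nat.Induction using (<-rec)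
open import Data.Nat.ListAction using (sum)
open import Data.Nat.Tactic.RingSolver using (solve-∀)
open import Data.Fin using (Fin; zero; suc; _≟_)
open import Data.Fin.Properties using (any?; all?)
open import Data.Fin.Subset.Properties using (anySubset?)
open import Data.Bool using (Bool; true; false; _∧_; _∨_; not; if_then_else_)
open import Data.Bool.Properties using (∨-zeroʳ; ¬-not) renaming (_≟_ to _≟ᵇ_)
open import Data.Bool.ListAction using (any; all; or; and)
open import Data.List using (List; []; _∷_; allFin; length)
open import Data.List.Properties using (map-tabulate; map-cong)
open import Data.List.Membership.Propositional using (_∈_)
open import Data.List.Relation.Unary.Any using (here; there)
import Data.List.Relation.Unary.Any as Any
open import Data.Vec using (lookup)
import Data.Vec as Vec
open import Data.Vec.Properties using (lookup∘tabulate)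
open import Data.Product using (Σ; _×_; _,_; ∃; ∃-syntax; proj₁; proj₂)
open import Data.Product.Properties using (≡-dec)
open import Data.Sum using (_⊎_; inj₁; inj₂; swap)
open import Data.Empty using (⊥-elim)
open import Function using (_∘_)
open import Relation.Nullary using (¬_; Dec; yes; no)
open import Relation.Nullary.Decidable using (map′; _×-dec_; _⊎-dec_; _→-dec_; ¬?)
open import Relation.Binary.PropositionalEquality

∨-split : ∀ x {y} → x ∨ y ≡ true → x ≡ true ⊎ y ≡ true
∨-split true  _ = inj₁ refl
∨-split false e = inj₂ e

∧-split : ∀ x {y} → x ∧ y ≡ true → x ≡ true × y ≡ true
∧-split true e = refl , e

∨-elim : ∀ x {y} {R : Set} → x ∨ y ≡ true → (x ≡ true → R) → (y ≡ true → R) → R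
∨-elim true _ left _ = left refl
∨-elim false e _ right = right e

true≢false : true ≢ false
true≢false ()

not-true : ∀ {x} → not x ≡ true → x ≡ false
not-true {false} _ = refl

∨-introˡ : ∀ {x} y → x ≡ true → x ∨ y ≡ true
∨-introˡ _ refl = refl

∨-introʳ : ∀ x {y} → y ≡ true → x ∨ y ≡ true
∨-introʳ x refl = ∨-zeroʳ x

==-refl : ∀ {n} (x : Fin n) → (x == x) ≡ true
==-refl x with x ≟ x
... | yes _ = refl
... | no x≢x = ⊥-elim (x≢x refl)

==-sound : ∀ {n} {x y : Fin n} → (x == y) ≡ true → x ≡ y
==-sound {x = x} {y} e with x ≟ y
... | yes x≡y = x≡y

==-apart : ∀ {n} {x y : Fin n} → (x == y) ≡ false → x ≢ y
==-apart {x = x} e refl with trans (sym e) (==-refl x)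
... | ()

==-≢ : ∀ {n} {x y : Fin n} → x ≢ y → (x == y) ≡ false
==-≢ {x = x} {y} x≢y with x ≟ y
... | yes x≡y = ⊥-elim (x≢y x≡y)
... | no _ = refl

-- Counting blue vertices.  'size' is a sum over allFin n; peeling off the
-- vertex zero turns every counting fact into an induction on n.

ind : Bool → ℕ
ind b = if b then 1 else 0

size-suc : ∀ {n} (S : Colouring (suc n)) → size S ≡ ind (S zero) + size (S ∘ suc)
size-suc {n} S = cong (λ xs → ind (S zero) + sum xs)
  (trans (map-tabulate suc (ind ∘ S)) (sym (map-tabulate (λ x → x) (ind ∘ S ∘ suc))))

ind-mono : ∀ {x y} → (x ≡ true → y ≡ true) → ind x ≤ ind y
ind-mono {false} _ = z≤n
ind-mono {true} h rewrite h refl = s≤s z≤n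

ind≤1 : ∀ x → ind x ≤ 1
ind≤1 x = ind-mono {x} {true} (λ _ → refl)

_⊆_ : ∀ {n} → Colouring n → Colouring n → Set
S ⊆ S' = ∀ x → S x ≡ true → S' x ≡ true

size-mono : ∀ {n} {S S' : Colouring n} → S ⊆ S' → size S ≤ size S'
size-mono {zero} _ = z≤n
size-mono {suc n} {S} {S'} h rewrite size-suc S | size-suc S' =
  +-mono-≤ (ind-mono (h zero)) (size-mono (h ∘ suc))

size-add≤ : ∀ {n} {S S' : Colouring n} v → (∀ x → S' x ≡ true → S x ≡ true ⊎ x ≡ v)
  → size S' ≤ suc (size S)
size-add≤ {suc n} {S} {S'} zero h rewrite size-suc S | size-suc S' =
  +-mono-≤ (ind≤1 (S' zero)) (≤-trans (size-mono only-old) (m≤n+m _ (ind (S zero))))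
  where
  only-old : (S' ∘ suc) ⊆ (S ∘ suc)
  only-old x e with h (suc x) e
  ... | inj₁ old = old
size-add≤ {suc n} {S} {S'} (suc v) h rewrite size-suc S | size-suc S' =
  subst (ind (S' zero) + size (S' ∘ suc) ≤_) (+-suc (ind (S zero)) _)
    (+-mono-≤ (ind-mono old-at-zero) (size-add≤ v λ x e → shift (h (suc x) e)))
  where
  old-at-zero : S' zero ≡ true → S zero ≡ true
  old-at-zero e with h zero e
  ... | inj₁ old = old
  shift : ∀ {x} → S (suc x) ≡ true ⊎ suc x ≡ suc v → S (suc x) ≡ true ⊎ x ≡ v
  shift (inj₁ old) = inj₁ old
  shift (inj₂ refl) = inj₂ refl

size-add≥ : ∀ {n} {S S' : Colouring n} v → S ⊆ S' → S v ≡ false → S' v ≡ true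
  → suc (size S) ≤ size S'
size-add≥ {suc n} {S} {S'} zero h sv s'v rewrite size-suc S | size-suc S' | sv | s'v =
  s≤s (size-mono (h ∘ suc))
size-add≥ {suc n} {S} {S'} (suc v) h sv s'v rewrite size-suc S | size-suc S' =
  subst (_≤ ind (S' zero) + size (S' ∘ suc)) (+-suc (ind (S zero)) _)
    (+-mono-≤ (ind-mono (h zero)) (size-add≥ v (h ∘ suc) sv s'v))

size≤n : ∀ {n} (S : Colouring n) → size S ≤ n
size≤n {zero} S = z≤n
size≤n {suc n} S rewrite size-suc S = +-mono-≤ (ind≤1 (S zero)) (size≤n (S ∘ suc))

n≤size : ∀ {n} (S : Colouring n) → AllBlue S → n ≤ size S
n≤size {zero} S _ = z≤n
n≤size {suc n} S all rewrite size-suc S | all zero = s≤s (n≤size (S ∘ suc) (all ∘ suc))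

paint-keeps : ∀ {n} (S : Colouring n) v → S ⊆ paint S v
paint-keeps S v x = ∨-introˡ (x == v)

paint-hits : ∀ {n} (S : Colouring n) v → paint S v v ≡ true
paint-hits S v = ∨-introʳ (S v) (==-refl v)

paint-new : ∀ {n} (S : Colouring n) v x → paint S v x ≡ true → S x ≡ true ⊎ x ≡ v
paint-new S v x e with ∨-split (S x) e
... | inj₁ old = inj₁ old
... | inj₂ new = inj₂ (==-sound new)

white-before : ∀ {n} (S : Colouring n) v x → paint S v x ≡ false → S x ≡ false
white-before S v x e with S x
white-before S v x () | true
white-before S v x e | false = refl

size-paint≤ : ∀ {n} (S : Colouring n) v → size (paint S v) ≤ suc (size S)
size-paint≤ S v = size-add≤ v (paint-new S v)

size-paint≥ : ∀ {n} (S : Colouring n) v → S v ≡ false → suc (size S) ≤ size (paint S v)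
size-paint≥ S v sv = size-add≥ v (paint-keeps S v) sv (paint-hits S v)

-- Structure of a valid sequence of forces: every force has an arc of D and
-- targets a vertex that is still white, and each vertex forces at most once,
-- because after its force all of its out-neighbours are blue.

forced-arc : ∀ {n} (D : Digraph n) {S F u x} → ValidSeq D S F → (u , x) ∈ F → D u x ≡ true
forced-arc D ((_ , _ , arc , _) , _) (here refl) = arc
forced-arc D {F = _ ∷ _} (_ , vs) (there m) = forced-arc D vs m

forced-white : ∀ {n} (D : Digraph n) {S F u x} → ValidSeq D S F → (u , x) ∈ F → S x ≡ false
forced-white D ((_ , white , _) , _) (here refl) = white
forced-white D {S} {(_ , w) ∷ _} {x = x} (_ , vs) (there m) =
  white-before S w x (forced-white D vs m)

no-second-force : ∀ {n} (D : Digraph n) {S F u x x'} → ValidForce D S u x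
  → ValidSeq D (paint S x) F → (u , x') ∈ F → x' ≡ x
no-second-force D {S} {x = x} {x'} (_ , _ , _ , only) vs m =
  only x' (forced-arc D vs m) (white-before S x x' (forced-white D vs m))

forces-once : ∀ {n} (D : Digraph n) {S F u x x'} → ValidSeq D S F
  → (u , x) ∈ F → (u , x') ∈ F → x ≡ x'
forces-once D (vf , vs) (here refl) (here refl) = refl
forces-once D (vf , vs) (here refl) (there m') = sym (no-second-force D vf vs m')
forces-once D (vf , vs) (there m) (here refl) = no-second-force D vf vs m
forces-once D {F = _ ∷ _} (_ , vs) (there m) (there m') = forces-once D vs m m'

-- Each force turns a new vertex blue, so a valid sequence has at most as many
-- forces as there are white vertices.
forces≤white : ∀ {n} (D : Digraph n) S F → ValidSeq D S F → size S + length F ≤ n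
forces≤white {n} D S [] _ = subst (_≤ n) (sym (+-identityʳ (size S))) (size≤n S)
forces≤white {n} D S ((u , w) ∷ F) ((_ , white , _) , vs) = begin
  size S + suc (length F)      ≡⟨ +-suc (size S) (length F) ⟩
  suc (size S) + length F      ≤⟨ +-monoˡ-≤ (length F) (size-paint≥ S w white) ⟩
  size (paint S w) + length F  ≤⟨ forces≤white D (paint S w) F vs ⟩
  n                            ∎
  where open ≤-Reasoning

any-witness : ∀ {A : Set} (p : A → Bool) xs → any p xs ≡ true → ∃[ x ] (x ∈ xs × p x ≡ true)
any-witness p (x ∷ xs) e with ∨-split (p x) e
... | inj₁ px = x , here refl , px
... | inj₂ rest with any-witness p xs rest
... | y , m , py = y , there m , py

iter-origin : ∀ {n} (D : Digraph n) F B t z → iter D F B t z ≡ true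
  → B z ≡ true ⊎ ∃[ u ] ((u , z) ∈ F)
iter-origin D F B zero z e = inj₁ e
iter-origin {n} D F B (suc t) z e with ∨-split (iter D F B t z) e
... | inj₁ earlier = iter-origin D F B t z earlier
... | inj₂ fired with any-witness _ F fired
... | (u , w) , m , fires = inj₂ (u , subst (λ v → (u , v) ∈ F) (==-sound (proj₁ (∧-split (w == z) fires))) m)

forces? : ∀ {n} (F : List (Force n)) u → Dec (∃[ x ] ((u , x) ∈ F))
forces? F u = any? (λ x → Any.any? (≡-dec _≟_ _≟_ (u , x)) F)

target : ∀ {n} → List (Force n) → Fin n → Fin n
target F u with forces? F u
... | yes (x , _) = x
... | no _ = u

target-unique : ∀ {n} (D : Digraph n) {S F u x} → ValidSeq D S F → (u , x) ∈ F → x ≡ target F u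
target-unique D {F = F} {u} vs m with forces? F u
... | yes (x' , m') = forces-once D vs m m'
... | no none = ⊥-elim (none (_ , m))

covered : ∀ {n} (B : Colouring n) L → (∀ x → B x ≡ true ⊎ x ∈ L) → n ≤ size B + length L
covered {n} B [] cover = subst (n ≤_) (sym (+-identityʳ (size B))) (n≤size B blue)
  where
  blue : AllBlue B
  blue x with cover x
  ... | inj₁ bx = bx
covered {n} B (v ∷ L) cover = begin
  n                            ≤⟨ covered (paint B v) L cover′ ⟩
  size (paint B v) + length L  ≤⟨ +-monoˡ-≤ (length L) (size-paint≤ B v) ⟩
  suc (size B) + length L      ≡⟨ sym (+-suc (size B) (length L)) ⟩
  size B + suc (length L)      ∎
  where
  open ≤-Reasoning
  cover′ : ∀ x → paint B v x ≡ true ⊎ x ∈ L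
  cover′ x with cover x
  ... | inj₁ bx = inj₁ (paint-keeps B v x bx)
  ... | inj₂ (here refl) = inj₁ (paint-hits B v)
  ... | inj₂ (there m) = inj₂ m

any-intro : ∀ {A : Set} (p : A → Bool) {x xs} → x ∈ xs → p x ≡ true → any p xs ≡ true
any-intro p (here refl) px = ∨-introˡ _ px
any-intro p {xs = y ∷ _} (there m) px = ∨-introʳ (p y) (any-intro p m px)

all-intro : ∀ {A : Set} (p : A → Bool) xs → (∀ x → p x ≡ true) → all p xs ≡ true
all-intro p [] _ = refl
all-intro p (x ∷ xs) h rewrite h x = all-intro p xs h

valid-fires : ∀ {n} (D : Digraph n) F S {u z} → ValidForce D S u z → (u , z) ∈ F → step D F S z ≡ true
valid-fires {n} D F S {u} {z} (blue , _ , arc , only) m =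
  ∨-introʳ (S z) (any-intro _ m fires)
  where
  others-blue : ∀ y → (not (D u y) ∨ S y ∨ (y == z)) ≡ true
  others-blue y with D u y in arc-y | S y in blue-y
  ... | false | _ = refl
  ... | true | true = refl
  ... | true | false = subst (λ v → (v == z) ≡ true) (sym (only y arc-y blue-y)) (==-refl z)
  fires : (z == z) ∧ S u ∧ D u z ∧ all (λ y → not (D u y) ∨ S y ∨ (y == z)) (allFin n) ≡ true
  fires rewrite ==-refl z | blue | arc = all-intro _ (allFin n) others-blue

valid-after-paint : ∀ {n} (D : Digraph n) S {u z} v → v ≢ z → ValidForce D S u z → ValidForce D (paint S v) u z
valid-after-paint D S {u} {z} v v≢z (blue , white , arc , only) =
  paint-keeps S v u blue , still-white , arc , λ x d wx → only x d (white-before S v x wx)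
  where
  still-white : paint S v z ≡ false
  still-white rewrite white | ==-≢ (v≢z ∘ sym) = refl

-- All notions of the forcing game depend on a colouring only through its values,
-- so they are invariant under pointwise equality; this lets the search below
-- range over colourings given as vectors.

paint-cong : ∀ {n} {S S' : Colouring n} w → S ≗ S' → paint S w ≗ paint S' w
paint-cong w h x = cong (_∨ (x == w)) (h x)

validForce-resp : ∀ {n} (D : Digraph n) {S S'} u w → S ≗ S' → ValidForce D S u w → ValidForce D S' u w
validForce-resp D u w h (blue , white , arc , only) =
  trans (sym (h u)) blue , trans (sym (h w)) white , arc , λ x dx sx → only x dx (trans (h x) sx)

validSeq-resp : ∀ {n} (D : Digraph n) {S S'} F → S ≗ S' → ValidSeq D S F → ValidSeq D S' F
validSeq-resp D [] h _ = _
validSeq-resp D ((u , w) ∷ F) h (vf , vs) =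
  validForce-resp D u w h vf , validSeq-resp D F (paint-cong w h) vs

run-cong : ∀ {n} {S S' : Colouring n} F → S ≗ S' → run S F ≗ run S' F
run-cong [] h = h
run-cong ((u , w) ∷ F) h = run-cong F (paint-cong w h)

forceSet-resp : ∀ {n} (D : Digraph n) {B B'} F → B ≗ B' → IsForceSet D B F → IsForceSet D B' F
forceSet-resp D F h (vs , stalled) =
  validSeq-resp D F h vs ,
  λ u w vf → stalled u w (validForce-resp D u w (λ x → sym (run-cong F h x)) vf)

step-cong : ∀ {n} (D : Digraph n) F {S S'} → S ≗ S' → step D F S ≗ step D F S'
step-cong {n} D F h x = cong₂ _∨_ (h x) (cong or (map-cong (λ { (u , w) →
  cong₂ (λ su rest → (w == x) ∧ su ∧ D u x ∧ rest) (h u)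
    (cong and (map-cong (λ y → cong (λ sy → not (D u y) ∨ sy ∨ (y == x)) (h y)) (allFin n))) }) F))

iter-cong : ∀ {n} (D : Digraph n) F {S S'} t → S ≗ S' → iter D F S t ≗ iter D F S' t
iter-cong D F zero h = h
iter-cong D F (suc t) h = step-cong D F (iter-cong D F t h)

size-cong : ∀ {n} {S S' : Colouring n} → S ≗ S' → size S ≡ size S'
size-cong {n} h = cong sum (map-cong (λ x → cong ind (h x)) (allFin n))

validForce? : ∀ {n} (D : Digraph n) S u w → Dec (ValidForce D S u w)
validForce? D S u w = S u ≟ᵇ true ×-dec S w ≟ᵇ false ×-dec D u w ≟ᵇ true
  ×-dec all? (λ x → D u x ≟ᵇ true →-dec S x ≟ᵇ false →-dec x ≟ w)

validSeq? : ∀ {n} (D : Digraph n) S F → Dec (ValidSeq D S F)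
validSeq? D S [] = yes _
validSeq? D S ((u , w) ∷ F) = validForce? D S u w ×-dec validSeq? D (paint S w) F

forceSet? : ∀ {n} (D : Digraph n) B F → Dec (IsForceSet D B F)
forceSet? D B F = validSeq? D B F ×-dec all? (λ u → all? (λ w → ¬? (validForce? D (run B F) u w)))

allBlue? : ∀ {n} (S : Colouring n) → Dec (AllBlue S)
allBlue? S = all? (λ x → S x ≟ᵇ true)

pair-exists? : ∀ {n} (P : Fin n × Fin n → Set) → (∀ p → Dec (P p)) → Dec (∃ P)
pair-exists? P P? = map′ (λ (u , w , p) → (u , w) , p) (λ ((u , w) , p) → u , w , p)
  (any? λ u → any? λ w → P? (u , w))

short-list? : ∀ {A : Set} → (∀ (P : A → Set) → (∀ a → Dec (P a)) → Dec (∃ P))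
  → ∀ k (Q : List A → Set) → (∀ xs → Dec (Q xs)) → Dec (∃[ xs ] (length xs ≤ k × Q xs))
short-list? exists? zero Q Q? = map′ (λ q → [] , z≤n , q) (λ { ([] , _ , q) → q }) (Q? [])
short-list? {A} exists? (suc k) Q Q? = map′ from to
  (Q? [] ⊎-dec exists? _ (λ a → short-list? exists? k (Q ∘ (a ∷_)) (Q? ∘ (a ∷_))))
  where
  from : Q [] ⊎ ∃[ a ] ∃[ xs ] (length xs ≤ k × Q (a ∷ xs)) → ∃[ xs ] (length xs ≤ suc k × Q xs)
  from (inj₁ q) = [] , z≤n , q
  from (inj₂ (a , xs , l , q)) = a ∷ xs , s≤s l , q
  to : ∃[ xs ] (length xs ≤ suc k × Q xs) → Q [] ⊎ ∃[ a ] ∃[ xs ] (length xs ≤ k × Q (a ∷ xs))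
  to ([] , _ , q) = inj₁ q
  to (a ∷ xs , s≤s l , q) = inj₂ (a , xs , l , q)

colouring-exists? : ∀ {n} (Q : Colouring n → Set) → (∀ {S S'} → S ≗ S' → Q S → Q S')
  → (∀ S → Dec (Q S)) → Dec (∃ Q)
colouring-exists? Q resp Q? = map′ (λ (s , q) → lookup s , q)
  (λ (S , q) → Vec.tabulate S , resp (λ x → sym (lookup∘tabulate S x)) q)
  (anySubset? (Q? ∘ lookup))

least : ∀ {P : ℕ → Set} → (∀ m → Dec (P m)) → ∀ k → P k → ∃[ m ] (P m × ∀ m' → P m' → m ≤ m')
least {P} P? = <-rec (λ k → P k → ∃[ m ] (P m × ∀ m' → P m' → m ≤ m')) search
  where
  search : ∀ k → (∀ {j} → j < k → P j → ∃[ m ] (P m × ∀ m' → P m' → m ≤ m'))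
    → P k → ∃[ m ] (P m × ∀ m' → P m' → m ≤ m')
  search k smaller pk with anyUpTo? P? k
  ... | yes (j , j<k , pj) = smaller j<k pj
  ... | no none = k , pk , λ m pm → ≮⇒≥ (λ m<k → none (m , m<k , pm))

AchievableFrom : ∀ {n} → Digraph n → ℕ → Colouring n → Set
AchievableFrom {n} D m B = Σ (List (Force n)) λ F → Σ ℕ λ t →
  IsForceSet D B F × AllBlue (iter D F B t) × size B + t ≡ m

Achievable : ∀ {n} → Digraph n → ℕ → Set
Achievable {n} D m = Σ (Colouring n) (AchievableFrom D m)

-- Once B and F are fixed, the only candidate time is m ∸ |B|.
achievable-by? : ∀ {n} (D : Digraph n) m B F
  → Dec (Σ ℕ λ t → IsForceSet D B F × AllBlue (iter D F B t) × size B + t ≡ m)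
achievable-by? D m B F with size B ≤? m
... | no B≰m = no λ (t , _ , _ , e) → B≰m (subst (size B ≤_) e (m≤m+n (size B) t))
... | yes B≤m = map′ (λ (fs , ab) → m ∸ size B , fs , ab , m+[n∸m]≡n B≤m)
  (λ (t , fs , ab , e) → fs , subst (AllBlue ∘ iter D F B) (time t e) ab)
  (forceSet? D B F ×-dec allBlue? (iter D F B (m ∸ size B)))
  where
  time : ∀ t → size B + t ≡ m → t ≡ m ∸ size B
  time t e = trans (sym (m+n∸m≡n (size B) t)) (cong (_∸ size B) e)

-- A set of forces of B has at most n elements, so only finitely many F need checking.
achievable-from? : ∀ {n} (D : Digraph n) m B → Dec (AchievableFrom D m B)
achievable-from? {n} D m B = map′ (λ (F , _ , q) → F , q)
  (λ (F , q@(_ , (vs , _) , _)) → F , ≤-trans (m≤n+m _ (size B)) (forces≤white D B F vs) , q)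
  (short-list? pair-exists? n _ (achievable-by? D m B))

achievable? : ∀ {n} (D : Digraph n) m → Dec (Achievable D m)
achievable? D m = colouring-exists? _ pointwise (achievable-from? D m)
  where
  pointwise : ∀ {B B'} → B ≗ B' → AchievableFrom D m B → AchievableFrom D m B'
  pointwise h (F , t , fs , ab , e) = F , t , forceSet-resp D F h fs ,
    (λ x → trans (sym (iter-cong D F t h x)) (ab x)) , trans (cong (_+ t) (sym (size-cong h))) e

throttling-exists : ∀ {n} (D : Digraph n) k → Achievable D k → Σ ℕ λ th → IsThrottlingNumber D th
throttling-exists D k achieved with least (achievable? D) k achieved
... | th , achieved-th , minimal = th , achieved-th , λ B F t fs ab → minimal _ (B , F , t , fs , ab , refl)

throttling-minimal : ∀ {n} (D : Digraph n) {th k} → IsThrottlingNumber D th → Achievable D k → th ≤ k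
throttling-minimal D (_ , minimal) (B , F , t , force-set , done , refl) = minimal B F t force-set done

-- Two simultaneous forces: if f₁ → v₁ and f₂ → v₂ are arcs while f₁ ↛ v₂ and
-- f₂ ↛ v₁, then starting with every vertex except v₁, v₂ blue, both are
-- forced in one round, which realises |B| + t = (n − 2) + 1.
module TwoForces {n} (D : Digraph n) {f₁ v₁ f₂ v₂ : Fin n} (v₁≢v₂ : v₁ ≢ v₂)
  (f₁≢v₁ : f₁ ≢ v₁) (f₁≢v₂ : f₁ ≢ v₂) (f₂≢v₁ : f₂ ≢ v₁) (f₂≢v₂ : f₂ ≢ v₂)
  (f₁→v₁ : D f₁ v₁ ≡ true) (f₂→v₂ : D f₂ v₂ ≡ true)
  (f₁↛v₂ : D f₁ v₂ ≡ false) (f₂↛v₁ : D f₂ v₁ ≡ false) where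

  B₀ : Colouring n
  B₀ x = not (x == v₁) ∧ not (x == v₂)

  F₀ : List (Force n)
  F₀ = (f₁ , v₁) ∷ (f₂ , v₂) ∷ []

  B₀-blue : ∀ {x} → x ≢ v₁ → x ≢ v₂ → B₀ x ≡ true
  B₀-blue x≢v₁ x≢v₂ rewrite ==-≢ x≢v₁ | ==-≢ x≢v₂ = refl

  B₀-cases : ∀ x → B₀ x ≡ true ⊎ x ≡ v₁ ⊎ x ≡ v₂
  B₀-cases x with x ≟ v₁ | x ≟ v₂
  ... | yes x≡v₁ | _ = inj₂ (inj₁ x≡v₁)
  ... | no _ | yes x≡v₂ = inj₂ (inj₂ x≡v₂)
  ... | no _ | no _ = inj₁ refl

  B₀-v₁ : B₀ v₁ ≡ false
  B₀-v₁ rewrite ==-refl v₁ = refl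

  B₀-v₂ : B₀ v₂ ≡ false
  B₀-v₂ rewrite ==-≢ (v₁≢v₂ ∘ sym) | ==-refl v₂ = refl

  -- The white vertices are v₁ and v₂, and fᵢ sees only vᵢ among them.
  sole-white : ∀ {f v v'} → D f v' ≡ false → (v ≡ v₁ × v' ≡ v₂) ⊎ (v ≡ v₂ × v' ≡ v₁)
    → ∀ x → D f x ≡ true → B₀ x ≡ false → x ≡ v
  sole-white f↛v' which x arc white with B₀-cases x | which
  ... | inj₁ blue | _ = ⊥-elim (true≢false (trans (sym blue) white))
  ... | inj₂ (inj₁ refl) | inj₁ (refl , _) = refl
  ... | inj₂ (inj₂ refl) | inj₁ (_ , refl) = ⊥-elim (true≢false (trans (sym arc) f↛v'))
  ... | inj₂ (inj₁ refl) | inj₂ (_ , refl) = ⊥-elim (true≢false (trans (sym arc) f↛v'))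
  ... | inj₂ (inj₂ refl) | inj₂ (refl , _) = refl

  valid₁ : ValidForce D B₀ f₁ v₁
  valid₁ = B₀-blue f₁≢v₁ f₁≢v₂ , B₀-v₁ , f₁→v₁ , sole-white f₁↛v₂ (inj₁ (refl , refl))

  valid₂ : ValidForce D B₀ f₂ v₂
  valid₂ = B₀-blue f₂≢v₁ f₂≢v₂ , B₀-v₂ , f₂→v₂ , sole-white f₂↛v₁ (inj₂ (refl , refl))

  valid₂-later : ValidForce D (paint B₀ v₁) f₂ v₂
  valid₂-later = valid-after-paint D B₀ v₁ v₁≢v₂ valid₂

  final-blue : AllBlue (run B₀ F₀)
  final-blue x with B₀-cases x
  ... | inj₁ blue = paint-keeps (paint B₀ v₁) v₂ x (paint-keeps B₀ v₁ x blue)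
  ... | inj₂ (inj₁ refl) = paint-keeps (paint B₀ v₁) v₂ v₁ (paint-hits B₀ v₁)
  ... | inj₂ (inj₂ refl) = paint-hits (paint B₀ v₁) v₂

  force-set : IsForceSet D B₀ F₀
  force-set = (valid₁ , valid₂-later , _) ,
    λ u z (_ , white , _) → true≢false (trans (sym (final-blue z)) white)

  one-round : AllBlue (iter D F₀ B₀ 1)
  one-round x with B₀-cases x
  ... | inj₁ blue = ∨-introˡ _ blue
  ... | inj₂ (inj₁ refl) = valid-fires D F₀ B₀ valid₁ (here refl)
  ... | inj₂ (inj₂ refl) = valid-fires D F₀ B₀ valid₂ (there (here refl))

  size-bound : size B₀ + 2 ≤ n
  size-bound = begin
    size B₀ + 2                 ≡⟨ +-comm (size B₀) 2 ⟩
    suc (suc (size B₀))         ≤⟨ s≤s (size-paint≥ B₀ v₁ B₀-v₁) ⟩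
    suc (size (paint B₀ v₁))    ≤⟨ size-paint≥ (paint B₀ v₁) v₂ (proj₁ (proj₂ valid₂-later)) ⟩
    size (run B₀ F₀)            ≤⟨ size≤n (run B₀ F₀) ⟩
    n                           ∎
    where open ≤-Reasoning

  below-n : Σ ℕ λ k → Achievable D k × k < n
  below-n = size B₀ + 1 , (B₀ , F₀ , 1 , force-set , one-round , refl) ,
    subst (_≤ n) (+-suc (size B₀) 1) size-bound

module AugmentedDoubleStar {n} (a b w : Fin n) (side : Fin n → Bool)
  (a≢b : a ≢ b) (a≢w : a ≢ w) (b≢w : b ≢ w) where

  Leaf : Fin n → Set
  Leaf x = x ≢ a × x ≢ b × x ≢ w

  -- The edges, each listed once and read from its centre end.
  data Spoke : Fin n → Fin n → Set where
    a–w : Spoke a w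
    b–w : Spoke b w
    a–leaf : ∀ {x} → Leaf x → side x ≡ true → Spoke a x
    b–leaf : ∀ {y} → Leaf y → side y ≡ false → Spoke b y

  Edge : Fin n → Fin n → Set
  Edge u v = Spoke u v ⊎ Spoke v u

  isLeaf : Fin n → Bool
  isLeaf x = not (x == a) ∧ not (x == b) ∧ not (x == w)

  isLeaf-sound : ∀ {x} → isLeaf x ≡ true → Leaf x
  isLeaf-sound {x} e with ∧-split (not (x == a)) e
  ... | x≢a , e' with ∧-split (not (x == b)) e'
  ... | x≢b , x≢w = ==-apart (not-true x≢a) , ==-apart (not-true x≢b) , ==-apart (not-true x≢w)

  pair-eq : ∀ {u v p q : Fin n} → (u == p ∧ v == q) ≡ true → u ≡ p × v ≡ q
  pair-eq {u} e with ∧-split (u == _) e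
  ... | u≡p , v≡q = ==-sound u≡p , ==-sound v≡q

  pair-spoke : ∀ {u v p q} → (u == p ∧ v == q) ≡ true → Spoke p q → Edge u v
  pair-spoke {u} {v} {p} {q} e s with pair-eq {u} {v} {p} {q} e
  ... | refl , refl = inj₁ s

  pair-spoke˘ : ∀ {u v p q} → (u == q ∧ v == p) ≡ true → Spoke p q → Edge u v
  pair-spoke˘ {u} {v} {p} {q} e s with pair-eq {u} {v} {q} {p} e
  ... | refl , refl = inj₂ s

  centre-leaf : ∀ {c u v : Fin n} {s} → (u == c ∧ isLeaf v ∧ s) ≡ true → u ≡ c × Leaf v × s ≡ true
  centre-leaf {c} {u} {v} e with ∧-split (u == c) e
  ... | u≡c , e' with ∧-split (isLeaf v) e'
  ... | leaf , s = ==-sound u≡c , isLeaf-sound leaf , s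

  a-spoke : ∀ {u v} → (u == a ∧ isLeaf v ∧ side v) ≡ true → Spoke u v
  a-spoke {u} {v} e with centre-leaf {a} {u} {v} {side v} e
  ... | refl , leaf , s = a–leaf leaf s

  b-spoke : ∀ {u v} → (u == b ∧ isLeaf v ∧ not (side v)) ≡ true → Spoke u v
  b-spoke {u} {v} e with centre-leaf {b} {u} {v} {not (side v)} e
  ... | refl , leaf , s = b–leaf leaf (not-true s)

  edge-view : ∀ u v → adsEdge a b w side u v ≡ true → Edge u v
  edge-view u v e =
    ∨-elim (u == a ∧ v == w) e (λ p → pair-spoke p a–w) λ e →
    ∨-elim (u == w ∧ v == a) e (λ p → pair-spoke˘ p a–w) λ e →
    ∨-elim (u == b ∧ v == w) e (λ p → pair-spoke p b–w) λ e →
    ∨-elim (u == w ∧ v == b) e (λ p → pair-spoke˘ p b–w) λ e →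
    ∨-elim (u == a ∧ isLeaf v ∧ side v) e (inj₁ ∘ a-spoke) λ e →
    ∨-elim (v == a ∧ isLeaf u ∧ side u) e (inj₂ ∘ a-spoke) λ e →
    ∨-elim (u == b ∧ isLeaf v ∧ not (side v)) e (inj₁ ∘ b-spoke) (inj₂ ∘ b-spoke)

  spoke-edge : ∀ {u v} → Spoke u v → adsEdge a b w side u v ≡ true
  spoke-edge a–w rewrite ==-refl a | ==-refl w = refl
  spoke-edge b–w rewrite ==-≢ (a≢b ∘ sym) | ==-≢ b≢w | ==-refl b | ==-refl w = refl
  spoke-edge (a–leaf (x≢a , x≢b , x≢w) s)
    rewrite ==-refl a | ==-≢ x≢a | ==-≢ x≢b | ==-≢ x≢w | ==-≢ a≢w | ==-≢ a≢b | s = refl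
  spoke-edge (b–leaf (y≢a , y≢b , y≢w) s)
    rewrite ==-refl b | ==-≢ y≢a | ==-≢ y≢b | ==-≢ y≢w | ==-≢ b≢w | ==-≢ (a≢b ∘ sym) | s = refl

  spoke-source : ∀ {u v} → Spoke u v → u ≡ a ⊎ u ≡ b
  spoke-source a–w = inj₁ refl
  spoke-source b–w = inj₂ refl
  spoke-source (a–leaf _ _) = inj₁ refl
  spoke-source (b–leaf _ _) = inj₂ refl

  spoke-target : ∀ {u v} → Spoke u v → v ≡ w ⊎ Leaf v
  spoke-target a–w = inj₁ refl
  spoke-target b–w = inj₁ refl
  spoke-target (a–leaf leaf _) = inj₂ leaf
  spoke-target (b–leaf leaf _) = inj₂ leaf

  centres-apart : ¬ Edge a b
  centres-apart (inj₁ s) with spoke-target s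
  ... | inj₁ b≡w = b≢w b≡w
  ... | inj₂ (_ , b≢b , _) = b≢b refl
  centres-apart (inj₂ s) with spoke-target s
  ... | inj₁ a≡w = a≢w a≡w
  ... | inj₂ (a≢a , _) = a≢a refl

  leaf-neighbour : ∀ {u z} → Leaf z → Edge u z → (u ≡ a × side z ≡ true) ⊎ (u ≡ b × side z ≡ false)
  leaf-neighbour (_ , _ , z≢w) (inj₁ a–w) = ⊥-elim (z≢w refl)
  leaf-neighbour (_ , _ , z≢w) (inj₁ b–w) = ⊥-elim (z≢w refl)
  leaf-neighbour _ (inj₁ (a–leaf _ s)) = inj₁ (refl , s)
  leaf-neighbour _ (inj₁ (b–leaf _ s)) = inj₂ (refl , s)
  leaf-neighbour (z≢a , z≢b , _) (inj₂ s) with spoke-source s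
  ... | inj₁ z≡a = ⊥-elim (z≢a z≡a)
  ... | inj₂ z≡b = ⊥-elim (z≢b z≡b)

  sides-apart : ∀ {x y} → side x ≡ true → side y ≡ false → x ≢ y
  sides-apart sx sy refl = true≢false (trans (sym sx) sy)

  a-not-adjacent : ∀ {y} → Leaf y → side y ≡ false → ¬ Edge a y
  a-not-adjacent ly sy e with leaf-neighbour ly e
  ... | inj₁ (_ , s) = true≢false (trans (sym s) sy)
  ... | inj₂ (a≡b , _) = a≢b a≡b

  b-not-adjacent : ∀ {x} → Leaf x → side x ≡ true → ¬ Edge b x
  b-not-adjacent lx sx e with leaf-neighbour lx e
  ... | inj₁ (b≡a , _) = a≢b (sym b≡a)
  ... | inj₂ (_ , s) = true≢false (trans (sym sx) s)

  leaves-apart : ∀ {x y} → Leaf x → Leaf y → ¬ Edge x y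
  leaves-apart (x≢a , x≢b , _) ly e with leaf-neighbour ly e
  ... | inj₁ (x≡a , _) = x≢a x≡a
  ... | inj₂ (x≡b , _) = x≢b x≡b

  module _ (D : Digraph n) (arc-edge : ∀ u v → D u v ≡ true → Edge u v) where

    -- Lower bound: only a, b, w and the leaf forced by each centre can start
    -- white, since a leaf is forced by its centre and a centre forces at most once.
    few-white : ∀ {B F t} → IsForceSet D B F → AllBlue (iter D F B t) → n ≤ size B + 5
    few-white {B} {F} {t} (forces , _) done =
      covered B (a ∷ b ∷ w ∷ target F a ∷ target F b ∷ []) cover
      where
      cover : ∀ x → B x ≡ true ⊎ x ∈ (a ∷ b ∷ w ∷ target F a ∷ target F b ∷ [])
      cover x with x ≟ a | x ≟ b | x ≟ w
      ... | yes refl | _ | _ = inj₂ (here refl)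
      ... | no _ | yes refl | _ = inj₂ (there (here refl))
      ... | no _ | no _ | yes refl = inj₂ (there (there (here refl)))
      ... | no x≢a | no x≢b | no x≢w with iter-origin D F B t x (done x)
      ... | inj₁ blue = inj₁ blue
      ... | inj₂ (u , m) with leaf-neighbour (x≢a , x≢b , x≢w) (arc-edge u x (forced-arc D forces m))
      ... | inj₁ (refl , _) = inj₂ (there (there (there (here (target-unique D forces m)))))
      ... | inj₂ (refl , _) = inj₂ (there (there (there (there (here (target-unique D forces m))))))

    achievable-large : ∀ {k} → Achievable D k → n ≤ k + 5
    achievable-large (B , F , t , force-set , done , refl) =
      ≤-trans (few-white {t = t} force-set done) (+-monoˡ-≤ 5 (m≤m+n (size B) t))

    no-arc : ∀ {u v} → ¬ Edge u v → D u v ≡ false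
    no-arc {u} {v} ¬edge = ¬-not (λ arc → ¬edge (arc-edge u v arc))

    -- Upper bound: orient the edges a–x and b–y towards leaves x (side a) and
    -- y (side b); in each of the four cases two independent forces exist.
    below-n : (∀ {u v} → Spoke u v → D u v ≡ true ⊎ D v u ≡ true)
      → ∀ {x y} → Leaf x → side x ≡ true → Leaf y → side y ≡ false
      → Σ ℕ λ k → Achievable D k × k < n
    below-n oriented {x} {y} lx@(x≢a , x≢b , _) sx ly@(y≢a , y≢b , _) sy
      with oriented (a–leaf lx sx) | oriented (b–leaf ly sy)
    ... | inj₁ a→x | inj₁ b→y = TwoForces.below-n D (sides-apart sx sy) (≢-sym x≢a) (≢-sym y≢a) (≢-sym x≢b) (≢-sym y≢b)
      a→x b→y (no-arc (a-not-adjacent ly sy)) (no-arc (b-not-adjacent lx sx))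
    ... | inj₁ a→x | inj₂ y→b = TwoForces.below-n D x≢b (≢-sym x≢a) a≢b (≢-sym (sides-apart sx sy)) y≢b
      a→x y→b (no-arc centres-apart) (no-arc ((leaves-apart lx ly) ∘ swap))
    ... | inj₂ x→a | inj₁ b→y = TwoForces.below-n D (≢-sym y≢a) x≢a (sides-apart sx sy) (≢-sym a≢b) (≢-sym y≢b)
      x→a b→y (no-arc (leaves-apart lx ly)) (no-arc (centres-apart ∘ swap))
    ... | inj₂ x→a | inj₂ y→b = TwoForces.below-n D a≢b x≢a x≢b y≢a y≢b
      x→a y→b (no-arc ((b-not-adjacent lx sx) ∘ swap)) (no-arc ((a-not-adjacent ly sy) ∘ swap))

-- Arithmetic: for c ≥ 7 we have 4(c + 5) ≤ c², since c² − 4c − 20 = (c − 2)² − 24.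
square-identity : ∀ j → (7 + j) * (7 + j) ≡ 4 * (7 + j + 5) + (1 + 10 * j + j * j)
square-identity = solve-∀

square-bound : ∀ c → 7 ≤ c → 4 * (c + 5) ≤ c * c
square-bound c 7≤c with m≤n⇒∃[o]m+o≡n 7≤c
... | j , refl = subst (4 * (7 + j + 5) ≤_) (sym (square-identity j)) (m≤m+n _ _)

beyond-ceiling : ∀ {n m c} → 12 ≤ n → n ≤ m + 5 → c * c < 4 * n → c < m
beyond-ceiling {n} {m} {c} 12≤n n≤m+5 c²<4n with c <? m
... | yes c<m = c<m
... | no c≮m = ⊥-elim (<⇒≱ c²<4n (begin
  4 * n        ≤⟨ *-monoʳ-≤ 4 n≤c+5 ⟩
  4 * (c + 5)  ≤⟨ square-bound c (+-cancelʳ-≤ 5 7 c (≤-trans 12≤n n≤c+5)) ⟩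
  c * c        ∎))
  where
  open ≤-Reasoning
  n≤c+5 : n ≤ c + 5
  n≤c+5 = ≤-trans n≤m+5 (+-monoˡ-≤ 5 (≮⇒≥ c≮m))

theorem3p12 : (n : ℕ) → 12 ≤ n → (G : Graph n) → IsAugmentedDoubleStar G
    → (D : Digraph n) → IsOrientation G D
    → Σ ℕ λ th → IsThrottlingNumber D th
        × (∀ c → IsCeil2SqrtMinus1 n c → c < th) × th < n
theorem3p12 n 12≤n G (a , b , w , side , a≢b , a≢w , b≢w , (x , x≢a , x≢b , x≢w , sx) ,
                     (y , y≢a , y≢b , y≢w , sy) , G-is-ads) D (arcs-are-edges , edges-oriented) =
  th , is-th , ceiling<th , th<n
  where
  open AugmentedDoubleStar a b w side a≢b a≢w b≢w

  arc-edge : ∀ u v → D u v ≡ true → Edge u v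
  arc-edge u v arc = edge-view u v (trans (sym (G-is-ads u v)) (arcs-are-edges u v arc))

  spoke-oriented : ∀ {u v} → Spoke u v → D u v ≡ true ⊎ D v u ≡ true
  spoke-oriented {u} {v} s with edges-oriented u v (trans (G-is-ads u v) (spoke-edge s))
  ... | inj₁ (forward , _) = inj₁ forward
  ... | inj₂ (_ , backward) = inj₂ backward

  witness : Σ ℕ λ k → Achievable D k × k < n
  witness = below-n D arc-edge spoke-oriented (x≢a , x≢b , x≢w) sx (y≢a , y≢b , y≢w) sy

  throttling : Σ ℕ λ th → IsThrottlingNumber D th
  throttling = throttling-exists D (proj₁ witness) (proj₁ (proj₂ witness))

  th : ℕ
  th = proj₁ throttling

  is-th : IsThrottlingNumber D th
  is-th = proj₂ throttling

  ceiling<th : ∀ c → IsCeil2SqrtMinus1 n c → c < th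
  ceiling<th c (_ , c²<4n) = beyond-ceiling 12≤n (achievable-large D arc-edge (proj₁ is-th)) c²<4n

  th<n : th < n
  th<n = ≤-<-trans (throttling-minimal D is-th (proj₁ (proj₂ witness))) (proj₂ (proj₂ witness))
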